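{- For every $n\ge 0$, the number of permutations of $[n]$ avoiding the barred pattern $\bar{4}23\bar{1}5$ is \[\sum_{k=0}^{n}\binom{\binom{k+1}{2}+n-k-1}{n-k}.\]
   Context: A permutation $\pi=\pi(1)\cdots\pi(n)$ of $[n]=\{1,\dots,n\}$ avoids the barred pattern $\bar{4}23\bar{1}5$ if every occurrence of the classical pattern $123$ in $\pi$ extends to an occurrence of $42315$ in which the letters $2,3,5$ of $42315$ are played by that occurrence of $123$. Explicitly: for all indices $a<b<c$ with $\pi(a)<\pi(b)<\pi(c)$, there exist an index $d<a$ with $\pi(b)<\pi(d)<\pi(c)$ and an index $e$ with $b<e<c$ and $\pi(e)<\pi(a)$. Binomial coefficients use the convention $\binom{m}{0}=1$ for all integers $m$ (including $m=-1$) and $\binom{m}{j}=0$ for $0\le m<j$. -}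

module Defs where

open import Data.Nat using (ℕ; zero; suc; _+_; _∸_; _<_)
open import Data.Nat.Combinatorics using (_C_)
open import Data.Fin using (Fin; toℕ)
open import Data.Vec using (Vec; lookup)
open import Data.Product using (Σ; _×_; ∃)
open import Data.List using (List; upTo; map)
open import Data.Nat.ListAction using (sum)
open import Function.Definitions using (Injective)
open import Relation.Binary.PropositionalEquality using (_≡_)

-- A permutation of [n] in one-line notation: π(i) = lookup π i (0-indexed values).
IsPerm : {n : ℕ} → Vec (Fin n) n → Set
IsPerm {n} π = Injective _≡_ _≡_ (lookup π)

val : {n : ℕ} → Vec (Fin n) n → Fin n → ℕ
val π i = toℕ (lookup π i)

idx : {n : ℕ} → Fin n → ℕ
idx = toℕ

-- π avoids the barred pattern 4̄23̄15: every occurrence a<b<c of 123 extends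
-- with some d<a with π(b)<π(d)<π(c) and some e with b<e<c and π(e)<π(a).
Avoids : {n : ℕ} → Vec (Fin n) n → Set
Avoids {n} π =
  (a b c : Fin n) → idx a < idx b → idx b < idx c →
  val π a < val π b → val π b < val π c →
  (Σ (Fin n) λ d → idx d < idx a × val π b < val π d × val π d < val π c)
  × (Σ (Fin n) λ e → idx b < idx e × idx e < idx c × val π e < val π a)

-- The top argument is computed in ℕ as (binom(k+1,2) + (n - k)) ∸ 1; this is
-- exact except when n = k = 0, where the true top is -1 and the bottom is 0,
-- so the paper's convention binom(-1,0) = 1 agrees with (0 C 0) = 1.
term : ℕ → ℕ → ℕ
term n k = (((suc k) C 2 + (n ∸ k)) ∸ 1) C (n ∸ k)

formula : ℕ → ℕ
formula n = sum (map (term n) (upTo (suc n)))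

-- Removing the maximum n from an avoider of length n + 1 leaves an avoider σ of
-- length n, and n can be put back exactly at the sites L at which every ascent
-- of σ ending before L extends by an earlier larger entry (the 4̄) and by a
-- smaller entry between the ascent and L (the 1̄).  Label σ by the numbers c of
-- such active sites and t of sites satisfying the second condition alone, site
-- 0 excluded.  Inserting at site 0 yields the label (t+1 , t+1), inserting at
-- the j-th other active site yields (j , t), so the avoiders form the
-- generating tree (c , t) ↝ (t+1 , t+1) (1 , t) … (c , t) rooted at (0 , 0).
-- Along the c-direction its level counts obey Pascal's rule, and unrolling them
-- gives the sum over k of the multichoose numbers ((binom(k+1,2) , n−k)).
module Submission where

open import Algebra.Properties.CommutativeSemigroup using (interchange)
open import Data.Bool using (Bool; true; false; if_then_else_)
open import Data.Empty using (⊥-elim)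
open import Data.Fin as Fin using (Fin; toℕ; punchIn; punchOut; fromℕ<; fromℕ; inject₁; lower₁)
open import Data.Fin.Properties
  using ( punchIn-mono-≤; punchIn-cancel-≤; punchIn-punchOut; punchOut-punchIn; punchInᵢ≢i
        ; punchIn-injective; toℕ-fromℕ<; toℕ-fromℕ; toℕ-inject₁; toℕ-lower₁; toℕ<n; toℕ-injective
        ; fromℕ≢inject₁; inject₁-injective; inject₁-lower₁; pigeonhole; any?; all? )
open import Data.List using (List; []; _∷_; _++_; map; applyUpTo; concatMap; length)
open import Data.List.Membership.Propositional using (_∈_; find; lose)
open import Data.List.Membership.Propositional.Properties
  using (∈-++⁺ˡ; ∈-++⁺ʳ; ∈-++⁻; ∈-concatMap⁺; ∈-concatMap⁻)
open import Data.List.Properties using (map-++; map-cong-local; ++-identityʳ)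
open import Data.List.Relation.Binary.Disjoint.Propositional using (Disjoint)
import Data.List.Relation.Unary.All as All
import Data.List.Relation.Unary.All.Properties as All
import Data.List.Relation.Unary.AllPairs as AllPairs
import Data.List.Relation.Unary.AllPairs.Properties as AllPairs
open import Data.List.Relation.Unary.Any using (here)
open import Data.List.Relation.Unary.Unique.Propositional using (Unique)
import Data.List.Relation.Unary.Unique.Propositional.Properties as Unique
open import Data.Nat
open import Data.Nat.Combinatorics using (_C_; nCk+nC[k+1]≡[n+1]C[k+1]; k>n⇒nCk≡0; nC1≡n)
open import Data.Nat.ListAction using (sum)
open import Data.Nat.ListAction.Properties using (sum-++)
open import Data.Nat.Properties
open import Data.Product using (Σ; ∃; _×_; _,_; proj₁; proj₂)
open import Data.Product.Function.NonDependent.Propositional using (_×-⇔_)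
open import Data.Sum using (_⊎_; inj₁; inj₂; [_,_]′)
open import Data.Vec as Vec using (Vec; lookup; insertAt; removeAt; tabulate)
open import Data.Vec.Properties
  using ( insertAt-lookup; insertAt-punchIn; removeAt-punchOut; insertAt-removeAt; lookup-map
        ; lookup∘tabulate; tabulate∘lookup; tabulate-cong )
open import Function using (_∘_)
open import Function.Bundles using (_⇔_; mk⇔; Equivalence)
open import Function.Construct.Composition using (_⇔-∘_)
open import Function.Definitions using (Injective)
open import Relation.Binary using (tri<; tri≈; tri>)
open import Relation.Binary.PropositionalEquality
open import Relation.Nullary using (Dec; yes; no; ¬_)
open import Relation.Nullary.Decidable using (_×-dec_; _→-dec_; does; dec-true; dec-false; does-⇔)
open ≡-Reasoning

open import Defs

-- Counting the generating tree

sumFrom1To : (ℕ → ℕ) → ℕ → ℕ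
sumFrom1To F zero    = 0
sumFrom1To F (suc c) = sumFrom1To F c + F (suc c)

-- Nodes at depth d below a node labelled (c , t) in the generating tree with
-- succession rule (c , t) ↝ (t+1 , t+1) (1 , t) (2 , t) … (c , t).
nodes : ℕ → ℕ → ℕ → ℕ
nodes zero    c t = 1
nodes (suc d) c t = nodes d (suc t) (suc t) + sumFrom1To (λ j → nodes d j t) c

nodes-pascal : ∀ d c t → nodes (suc d) (suc c) t ≡ nodes d (suc c) t + nodes (suc d) c t
nodes-pascal d c t = trans (sym (+-assoc x s y)) (+-comm (x + s) y)
  where
  x = nodes d (suc t) (suc t)
  s = sumFrom1To (λ j → nodes d j t) c
  y = nodes d (suc c) t

multichoose : ℕ → ℕ → ℕ
multichoose N       zero    = 1
multichoose zero    (suc m) = 0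
multichoose (suc N) (suc m) = multichoose (suc N) m + multichoose N (suc m)

multichoose≡C : ∀ N m → multichoose N m ≡ (N + m ∸ 1) C m
multichoose≡C N       zero    = refl
multichoose≡C zero    (suc m) = sym (k>n⇒nCk≡0 (n<1+n m))
multichoose≡C (suc N) (suc m) = begin
  multichoose (suc N) m + multichoose N (suc m)  ≡⟨ cong₂ _+_ (multichoose≡C (suc N) m) (multichoose≡C N (suc m)) ⟩
  (N + m) C m + (N + suc m ∸ 1) C suc m           ≡⟨ cong (λ k → (N + m) C m + (k ∸ 1) C suc m) (+-suc N m) ⟩
  (N + m) C m + (N + m) C suc m                   ≡⟨ nCk+nC[k+1]≡[n+1]C[k+1] (N + m) m ⟩
  suc (N + m) C suc m                             ≡⟨ cong (λ k → k C suc m) (sym (+-suc N m)) ⟩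
  (N + suc m) C suc m                             ∎

nodesClosed : ℕ → ℕ → ℕ → ℕ
nodesClosed zero    c t = 1
nodesClosed (suc d) c t = multichoose c (suc d) + nodesClosed d (c + suc t) (suc t)

nodesClosed-pascal : ∀ d c t →
  nodesClosed (suc d) (suc c) t ≡ nodesClosed d (suc c) t + nodesClosed (suc d) c t
nodesClosed-pascal zero    c t = +-assoc 1 (multichoose c 1) 1
nodesClosed-pascal (suc d) c t =
  trans (cong (multichoose (suc c) (suc (suc d)) +_) (nodesClosed-pascal d (c + suc t) (suc t)))
        (interchange +-commutativeSemigroup (multichoose (suc c) (suc d)) (multichoose c (suc (suc d))) _ _)

nodes≡nodesClosed : ∀ d c t → nodes d c t ≡ nodesClosed d c t
nodes≡nodesClosed zero    c       t = refl
nodes≡nodesClosed (suc d) zero    t = trans (+-identityʳ _) (nodes≡nodesClosed d (suc t) (suc t))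
nodes≡nodesClosed (suc d) (suc c) t = begin
  nodes (suc d) (suc c) t
    ≡⟨ nodes-pascal d c t ⟩
  nodes d (suc c) t + nodes (suc d) c t
    ≡⟨ cong₂ _+_ (nodes≡nodesClosed d (suc c) t) (nodes≡nodesClosed (suc d) c t) ⟩
  nodesClosed d (suc c) t + nodesClosed (suc d) c t
    ≡⟨ nodesClosed-pascal d c t ⟨
  nodesClosed (suc d) (suc c) t  ∎

triangle : ℕ → ℕ
triangle t = suc t C 2

triangle-suc : ∀ t → triangle t + suc t ≡ triangle (suc t)
triangle-suc t = begin
  triangle t + suc t        ≡⟨ +-comm (triangle t) (suc t) ⟩
  suc t + triangle t        ≡⟨ cong (_+ triangle t) (nC1≡n (suc t)) ⟨
  suc t C 1 + suc t C 2     ≡⟨ nCk+nC[k+1]≡[n+1]C[k+1] (suc t) 1 ⟩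
  triangle (suc t)          ∎

applyUpTo-cong : ∀ {f g : ℕ → ℕ} → (∀ i → f i ≡ g i) → ∀ k → applyUpTo f k ≡ applyUpTo g k
applyUpTo-cong f≗g zero    = refl
applyUpTo-cong f≗g (suc k) = cong₂ _∷_ (f≗g 0) (applyUpTo-cong (f≗g ∘ suc) k)

map-applyUpTo : ∀ (g f : ℕ → ℕ) k → map g (applyUpTo f k) ≡ applyUpTo (g ∘ f) k
map-applyUpTo g f zero    = refl
map-applyUpTo g f (suc k) = cong (g (f 0) ∷_) (map-applyUpTo g (f ∘ suc) k)

nodesClosed-triangle : ∀ d t →
  nodesClosed d (triangle t) t ≡ sum (applyUpTo (λ i → multichoose (triangle (t + i)) (d ∸ i)) (suc d))
nodesClosed-triangle zero    t = refl
nodesClosed-triangle (suc d) t = cong₂ _+_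
  (cong (λ s → multichoose (triangle s) (suc d)) (sym (+-identityʳ t)))
  (begin
    nodesClosed d (triangle t + suc t) (suc t)   ≡⟨ cong (λ c → nodesClosed d c (suc t)) (triangle-suc t) ⟩
    nodesClosed d (triangle (suc t)) (suc t)     ≡⟨ nodesClosed-triangle d (suc t) ⟩
    sum (applyUpTo (λ i → multichoose (triangle (suc t + i)) (d ∸ i)) (suc d))
      ≡⟨ cong sum (applyUpTo-cong (λ i → cong (λ s → multichoose (triangle s) (d ∸ i)) (sym (+-suc t i))) (suc d)) ⟩
    sum (applyUpTo (λ i → multichoose (triangle (t + suc i)) (d ∸ i)) (suc d))  ∎)

formula≡nodes : ∀ n → formula n ≡ nodes n 0 0
formula≡nodes n = begin
  sum (map (term n) (applyUpTo (λ i → i) (suc n)))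
    ≡⟨ cong sum (map-applyUpTo (term n) (λ i → i) (suc n)) ⟩
  sum (applyUpTo (term n) (suc n))
    ≡⟨ cong sum (applyUpTo-cong (λ k → sym (multichoose≡C (triangle k) (n ∸ k))) (suc n)) ⟩
  sum (applyUpTo (λ k → multichoose (triangle k) (n ∸ k)) (suc n))
    ≡⟨ nodesClosed-triangle n 0 ⟨
  nodesClosed n 0 0
    ≡⟨ nodes≡nodesClosed n 0 0 ⟨
  nodes n 0 0  ∎

punchIn-onto : ∀ {m} (p x : Fin (suc m)) → x ≢ p → ∃ λ j → x ≡ punchIn p j
punchIn-onto p x x≢p = punchOut (x≢p ∘ sym) , sym (punchIn-punchOut (x≢p ∘ sym))

toℕ-punchIn-< : ∀ {m} (p : Fin (suc m)) (j : Fin m) → toℕ j < toℕ p → toℕ (punchIn p j) ≡ toℕ j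
toℕ-punchIn-< (Fin.suc p) Fin.zero    _         = refl
toℕ-punchIn-< (Fin.suc p) (Fin.suc j) (s≤s j<p) = cong suc (toℕ-punchIn-< p j j<p)

toℕ-punchIn-≥ : ∀ {m} (p : Fin (suc m)) (j : Fin m) → toℕ p ≤ toℕ j → toℕ (punchIn p j) ≡ suc (toℕ j)
toℕ-punchIn-≥ Fin.zero    j           _         = refl
toℕ-punchIn-≥ (Fin.suc p) (Fin.suc j) (s≤s p≤j) = cong suc (toℕ-punchIn-≥ p j p≤j)

punchIn-mono-< : ∀ {m} (p : Fin (suc m)) (a b : Fin m) → toℕ a < toℕ b → toℕ (punchIn p a) < toℕ (punchIn p b)
punchIn-mono-< p a b a<b = ≰⇒> λ b′≤a′ → <⇒≱ a<b (punchIn-cancel-≤ p b a b′≤a′)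

punchIn-cancel-< : ∀ {m} (p : Fin (suc m)) (a b : Fin m) → toℕ (punchIn p a) < toℕ (punchIn p b) → toℕ a < toℕ b
punchIn-cancel-< p a b a′<b′ = ≰⇒> λ b≤a → <⇒≱ a′<b′ (punchIn-mono-≤ p b a b≤a)

toℕ≤toℕ-punchIn : ∀ {m} (p : Fin (suc m)) (j : Fin m) → toℕ j ≤ toℕ (punchIn p j)
toℕ≤toℕ-punchIn p j with toℕ j <? toℕ p
... | yes j<p = ≤-reflexive (sym (toℕ-punchIn-< p j j<p))
... | no  j≮p = subst (toℕ j ≤_) (sym (toℕ-punchIn-≥ p j (≮⇒≥ j≮p))) (n≤1+n _)

toℕ-punchIn≤suc : ∀ {m} (p : Fin (suc m)) (j : Fin m) → toℕ (punchIn p j) ≤ suc (toℕ j)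
toℕ-punchIn≤suc p j with toℕ j <? toℕ p
... | yes j<p = subst (_≤ suc (toℕ j)) (sym (toℕ-punchIn-< p j j<p)) (n≤1+n _)
... | no  j≮p = ≤-reflexive (toℕ-punchIn-≥ p j (≮⇒≥ j≮p))

punchIn-<-bound : ∀ {m} (p : Fin (suc m)) (j : Fin m) {L} → L ≤ toℕ p → toℕ j < L → toℕ (punchIn p j) < L
punchIn-<-bound p j {L} L≤p j<L = subst (_< L) (sym (toℕ-punchIn-< p j (<-≤-trans j<L L≤p))) j<L

punchIn-<-suc-bound : ∀ {m} (p : Fin (suc m)) (j : Fin m) {L} → toℕ p ≡ 0 ⊎ toℕ p < L →
  toℕ (punchIn p j) < suc L → toℕ j < L
punchIn-<-suc-bound p j {L} p≡0⊎p<L j′<1+L with toℕ j <? toℕ p | p≡0⊎p<L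
... | yes j<p | inj₁ p≡0 = ⊥-elim (n≮0 (subst (toℕ j <_) p≡0 j<p))
... | yes j<p | inj₂ p<L = <-trans j<p p<L
... | no  j≮p | _        = s≤s⁻¹ (subst (_< suc L) (toℕ-punchIn-≥ p j (≮⇒≥ j≮p)) j′<1+L)

-- Inserting a new maximum into a sequence

-- Avoids π unfolds to AvoidsSeq (val π).
ExtendsTo42315 : ∀ {m} → (Fin m → ℕ) → Fin m → Fin m → Fin m → Set
ExtendsTo42315 {m} f a b c =
  (Σ (Fin m) λ d → toℕ d < toℕ a × f b < f d × f d < f c)
  × (Σ (Fin m) λ e → toℕ b < toℕ e × toℕ e < toℕ c × f e < f a)

AvoidsSeq : ∀ {m} → (Fin m → ℕ) → Set
AvoidsSeq {m} f =
  (a b c : Fin m) → toℕ a < toℕ b → toℕ b < toℕ c →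
  f a < f b → f b < f c → ExtendsTo42315 f a b c

-- Inserting a new maximum in front of position L turns each ascent a < b < L
-- into an occurrence of 123; BarFour and BarOne ask for its witnesses d (the
-- 4̄) and e (the 1̄) of the pattern 4̄231̄5.
BarFour : ∀ {m} → (Fin m → ℕ) → ℕ → Set
BarFour {m} f L = (a b : Fin m) → toℕ a < toℕ b → toℕ b < L → f a < f b →
  Σ (Fin m) λ d → toℕ d < toℕ a × f b < f d

BarOne : ∀ {m} → (Fin m → ℕ) → ℕ → Set
BarOne {m} f L = (a b : Fin m) → toℕ a < toℕ b → toℕ b < L → f a < f b →
  Σ (Fin m) λ e → toℕ b < toℕ e × toℕ e < L × f e < f a

Active : ∀ {m} → (Fin m → ℕ) → ℕ → Set
Active f L = BarFour f L × BarOne f L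

-- Opaque so that `with active? …` in the definition of children abstracts
-- over a single neutral term.
opaque
  barFour? : ∀ {m} (f : Fin m → ℕ) L → Dec (BarFour f L)
  barFour? f L = all? λ a → all? λ b →
    (toℕ a <? toℕ b) →-dec (toℕ b <? L) →-dec (f a <? f b) →-dec
    any? λ d → (toℕ d <? toℕ a) ×-dec (f b <? f d)

  barOne? : ∀ {m} (f : Fin m → ℕ) L → Dec (BarOne f L)
  barOne? f L = all? λ a → all? λ b →
    (toℕ a <? toℕ b) →-dec (toℕ b <? L) →-dec (f a <? f b) →-dec
    any? λ e → (toℕ b <? toℕ e) ×-dec (toℕ e <? L) ×-dec (f e <? f a)

  active? : ∀ {m} (f : Fin m → ℕ) L → Dec (Active f L)
  active? f L = barFour? f L ×-dec barOne? f L

barOne-zero : ∀ {m} (f : Fin m → ℕ) → BarOne f 0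
barOne-zero f a b _ ()

active-zero : ∀ {m} (f : Fin m → ℕ) → Active f 0
active-zero f = (λ a b _ ()) , barOne-zero f

barOne⇒ltrMin : ∀ {m} (g : Fin m → ℕ) → Injective _≡_ _≡_ g → ∀ z → BarOne g (suc (toℕ z)) →
  ∀ a → toℕ a < toℕ z → g z < g a
barOne⇒ltrMin g g-inj z barOne a a<z with <-cmp (g a) (g z)
... | tri< ga<gz _ _ with barOne a z a<z ≤-refl ga<gz
...   | e , z<e , e≤z , _ = ⊥-elim (<-irrefl refl (<-≤-trans z<e (s≤s⁻¹ e≤z)))
barOne⇒ltrMin g g-inj z barOne a a<z | tri≈ _ ga≡gz _ = ⊥-elim (<-irrefl (cong toℕ (g-inj ga≡gz)) a<z)
barOne⇒ltrMin g g-inj z barOne a a<z | tri> _ _ gz<ga = gz<ga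

module InsertMaximum {m : ℕ} (f : Fin (suc m) → ℕ) (g : Fin m → ℕ) (p : Fin (suc m)) (N : ℕ)
  (f-p : f p ≡ N) (f-punchIn : ∀ j → f (punchIn p j) ≡ g j) (g<N : ∀ j → g j < N) where

  P : ℕ
  P = toℕ p

  f-punchIn<N : ∀ j → f (punchIn p j) < N
  f-punchIn<N j = subst (_< N) (sym (f-punchIn j)) (g<N j)

  f≤N : ∀ x → f x ≤ N
  f≤N x with x Fin.≟ p
  ... | yes refl = ≤-reflexive f-p
  ... | no  x≢p with punchIn-onto p x x≢p
  ...   | j , refl = <⇒≤ (f-punchIn<N j)

  f<N⇒punchIn : ∀ x → f x < N → ∃ λ j → x ≡ punchIn p j
  f<N⇒punchIn x fx<N = punchIn-onto p x λ { refl → <-irrefl f-p fx<N }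

  <P⇒punchIn : ∀ x → toℕ x < P → ∃ λ j → x ≡ punchIn p j
  <P⇒punchIn x x<P = punchIn-onto p x λ { refl → <-irrefl refl x<P }

  punchIn-<⁺ : ∀ {j k} → g j < g k → f (punchIn p j) < f (punchIn p k)
  punchIn-<⁺ {j} {k} = subst₂ _<_ (sym (f-punchIn j)) (sym (f-punchIn k))

  punchIn-<⁻ : ∀ {j k} → f (punchIn p j) < f (punchIn p k) → g j < g k
  punchIn-<⁻ {j} {k} = subst₂ _<_ (f-punchIn j) (f-punchIn k)

  injective⁺ : Injective _≡_ _≡_ g → Injective _≡_ _≡_ f
  injective⁺ g-inj {x} {y} fx≡fy with x Fin.≟ p | y Fin.≟ p
  ... | yes refl | yes refl = refl
  ... | yes refl | no  y≢p with punchIn-onto p y y≢p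
  ...   | k , refl = ⊥-elim (<-irrefl (trans (sym fx≡fy) f-p) (f-punchIn<N k))
  injective⁺ g-inj {x} {y} fx≡fy | no x≢p | yes refl with punchIn-onto p x x≢p
  ...   | j , refl = ⊥-elim (<-irrefl (trans fx≡fy f-p) (f-punchIn<N j))
  injective⁺ g-inj {x} {y} fx≡fy | no x≢p | no y≢p with punchIn-onto p x x≢p | punchIn-onto p y y≢p
  ...   | j , refl | k , refl = cong (punchIn p) (g-inj (trans (sym (f-punchIn j)) (trans fx≡fy (f-punchIn k))))

  injective⁻ : Injective _≡_ _≡_ f → Injective _≡_ _≡_ g
  injective⁻ f-inj {j} {k} gj≡gk =
    punchIn-injective p j k (f-inj (trans (f-punchIn j) (trans gj≡gk (sym (f-punchIn k)))))

  f-punchIn<f-p : ∀ j → f (punchIn p j) < f p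
  f-punchIn<f-p j = subst (f (punchIn p j) <_) (sym f-p) (f-punchIn<N j)

  avoids-remove : AvoidsSeq f → AvoidsSeq g
  avoids-remove av a b c a<b b<c ga<gb gb<gc
    with av (punchIn p a) (punchIn p b) (punchIn p c) (punchIn-mono-< p a b a<b) (punchIn-mono-< p b c b<c)
            (punchIn-<⁺ ga<gb) (punchIn-<⁺ gb<gc)
  ... | (d′ , d<a , fb<fd , fd<fc) , (e′ , b<e , e<c , fe<fa)
    with f<N⇒punchIn d′ (<-≤-trans fd<fc (f≤N _)) | f<N⇒punchIn e′ (<-≤-trans fe<fa (f≤N _))
  ... | d , refl | e , refl =
    (d , punchIn-cancel-< p d a d<a , punchIn-<⁻ fb<fd , punchIn-<⁻ fd<fc) ,
    (e , punchIn-cancel-< p b e b<e , punchIn-cancel-< p e c e<c , punchIn-<⁻ fe<fa)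

  avoids⇒active : AvoidsSeq f → Active g P
  avoids⇒active av = barFour , barOne
    where
    occurrence : ∀ a b → toℕ a < toℕ b → toℕ b < P → g a < g b →
                 ExtendsTo42315 f (punchIn p a) (punchIn p b) p
    occurrence a b a<b b<P ga<gb =
      av (punchIn p a) (punchIn p b) p (punchIn-mono-< p a b a<b) (punchIn-<-bound p b ≤-refl b<P)
         (punchIn-<⁺ ga<gb) (f-punchIn<f-p b)

    barFour : BarFour g P
    barFour a b a<b b<P ga<gb with occurrence a b a<b b<P ga<gb
    ... | (d′ , d<a , fb<fd , fd<fp) , _ with f<N⇒punchIn d′ (subst (f d′ <_) f-p fd<fp)
    ... | d , refl = d , punchIn-cancel-< p d a d<a , punchIn-<⁻ fb<fd

    barOne : BarOne g P
    barOne a b a<b b<P ga<gb with occurrence a b a<b b<P ga<gb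
    ... | _ , (e′ , b<e , e<p , fe<fa) with f<N⇒punchIn e′ (<-≤-trans fe<fa (f≤N _))
    ... | e , refl = e , punchIn-cancel-< p b e b<e , ≤-<-trans (toℕ≤toℕ-punchIn p e) e<p , punchIn-<⁻ fe<fa

  active⇒avoids : AvoidsSeq g → Active g P → AvoidsSeq f
  active⇒avoids avg (barFour , barOne) a′ b′ c′ a<b b<c fa<fb fb<fc
    with f<N⇒punchIn a′ (<-trans fa<fb (<-≤-trans fb<fc (f≤N c′))) | f<N⇒punchIn b′ (<-≤-trans fb<fc (f≤N c′))
  ... | a , refl | b , refl with c′ Fin.≟ p
  ... | yes refl
    with barFour a b (punchIn-cancel-< p a b a<b) (≤-<-trans (toℕ≤toℕ-punchIn p b) b<c) (punchIn-<⁻ fa<fb)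
       | barOne  a b (punchIn-cancel-< p a b a<b) (≤-<-trans (toℕ≤toℕ-punchIn p b) b<c) (punchIn-<⁻ fa<fb)
  ...   | d , d<a , gb<gd | e , b<e , e<P , ge<ga =
    (punchIn p d , punchIn-mono-< p d a d<a , punchIn-<⁺ gb<gd , f-punchIn<f-p d) ,
    (punchIn p e , punchIn-mono-< p b e b<e , punchIn-<-bound p e ≤-refl e<P , punchIn-<⁺ ge<ga)
  active⇒avoids avg _ _ _ c′ a<b b<c fa<fb fb<fc | a , refl | b , refl | no c′≢p
    with punchIn-onto p c′ c′≢p
  ... | c , refl
    with avg a b c (punchIn-cancel-< p a b a<b) (punchIn-cancel-< p b c b<c) (punchIn-<⁻ fa<fb) (punchIn-<⁻ fb<fc)
  ... | (d , d<a , gb<gd , gd<gc) , (e , b<e , e<c , ge<ga) =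
    (punchIn p d , punchIn-mono-< p d a d<a , punchIn-<⁺ gb<gd , punchIn-<⁺ gd<gc) ,
    (punchIn p e , punchIn-mono-< p b e b<e , punchIn-mono-< p e c e<c , punchIn-<⁺ ge<ga)

  barFour-before : ∀ {L} → L ≤ P → BarFour f L ⇔ BarFour g L
  barFour-before {L} L≤P = mk⇔ to from
    where
    to : BarFour f L → BarFour g L
    to barFour a b a<b b<L ga<gb
      with barFour (punchIn p a) (punchIn p b) (punchIn-mono-< p a b a<b) (punchIn-<-bound p b L≤P b<L) (punchIn-<⁺ ga<gb)
    ... | d′ , d<a , fb<fd
      with <P⇒punchIn d′ (<-trans d<a (punchIn-<-bound p a ≤-refl (<-trans a<b (<-≤-trans b<L L≤P))))
    ... | d , refl = d , punchIn-cancel-< p d a d<a , punchIn-<⁻ fb<fd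

    from : BarFour g L → BarFour f L
    from barFour a′ b′ a<b b<L fa<fb
      with <P⇒punchIn a′ (<-trans a<b (<-≤-trans b<L L≤P)) | <P⇒punchIn b′ (<-≤-trans b<L L≤P)
    ... | a , refl | b , refl
      with barFour a b (punchIn-cancel-< p a b a<b) (≤-<-trans (toℕ≤toℕ-punchIn p b) b<L) (punchIn-<⁻ fa<fb)
    ... | d , d<a , gb<gd = punchIn p d , punchIn-mono-< p d a d<a , punchIn-<⁺ gb<gd

  barOne-before : ∀ {L} → L ≤ P → BarOne f L ⇔ BarOne g L
  barOne-before {L} L≤P = mk⇔ to from
    where
    to : BarOne f L → BarOne g L
    to barOne a b a<b b<L ga<gb
      with barOne (punchIn p a) (punchIn p b) (punchIn-mono-< p a b a<b) (punchIn-<-bound p b L≤P b<L) (punchIn-<⁺ ga<gb)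
    ... | e′ , b<e , e<L , fe<fa with <P⇒punchIn e′ (<-≤-trans e<L L≤P)
    ... | e , refl = e , punchIn-cancel-< p b e b<e , ≤-<-trans (toℕ≤toℕ-punchIn p e) e<L , punchIn-<⁻ fe<fa

    from : BarOne g L → BarOne f L
    from barOne a′ b′ a<b b<L fa<fb
      with <P⇒punchIn a′ (<-trans a<b (<-≤-trans b<L L≤P)) | <P⇒punchIn b′ (<-≤-trans b<L L≤P)
    ... | a , refl | b , refl
      with barOne a b (punchIn-cancel-< p a b a<b) (≤-<-trans (toℕ≤toℕ-punchIn p b) b<L) (punchIn-<⁻ fa<fb)
    ... | e , b<e , e<L , ge<ga =
      punchIn p e , punchIn-mono-< p b e b<e , punchIn-<-bound p e L≤P e<L , punchIn-<⁺ ge<ga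

  barOne-after : Injective _≡_ _≡_ g → ∀ {L} → L ≤ m → P ≡ 0 ⊎ P < L → BarOne f (suc L) ⇔ BarOne g L
  barOne-after g-inj {L} L≤m P≡0⊎P<L = mk⇔ to from
    where
    to : BarOne f (suc L) → BarOne g L
    to barOne a b a<b b<L ga<gb
      with barOne (punchIn p a) (punchIn p b) (punchIn-mono-< p a b a<b)
                  (s≤s (≤-trans (toℕ-punchIn≤suc p b) b<L)) (punchIn-<⁺ ga<gb)
    ... | e′ , b<e , e<1+L , fe<fa with f<N⇒punchIn e′ (<-trans fe<fa (f-punchIn<N a))
    ... | e , refl =
      e , punchIn-cancel-< p b e b<e , punchIn-<-suc-bound p e P≡0⊎P<L e<1+L , punchIn-<⁻ fe<fa

    from : BarOne g L → BarOne f (suc L)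
    from barOne a′ b′ a<b b<1+L fa<fb with f<N⇒punchIn a′ (<-≤-trans fa<fb (f≤N b′))
    from barOne _ b′ a<b b<1+L fa<fb | a , refl with b′ Fin.≟ p
    ... | no b′≢p with punchIn-onto p b′ b′≢p
    ...   | b , refl
      with barOne a b (punchIn-cancel-< p a b a<b) (punchIn-<-suc-bound p b P≡0⊎P<L b<1+L) (punchIn-<⁻ fa<fb)
    ...   | e , b<e , e<L , ge<ga =
      punchIn p e , punchIn-mono-< p b e b<e , s≤s (≤-trans (toℕ-punchIn≤suc p e) e<L) , punchIn-<⁺ ge<ga
    from barOne _ _ a<p _ _ | a , refl | yes refl = lastBeforeL P<L
      where
      P<L : P < L
      P<L = [ (λ P≡0 → ⊥-elim (n≮0 (subst (toℕ (punchIn p a) <_) P≡0 a<p))) , (λ P<L → P<L) ]′ P≡0⊎P<L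

      -- the witness is the entry just before site L, pushed right by the insertion
      lastBeforeL : P < L → Σ (Fin (suc m)) λ e → P < toℕ e × toℕ e < suc L × f e < f (punchIn p a)
      lastBeforeL (s≤s {n = L′} P≤L′) =
        punchIn p z , subst (P <_) (sym z′≡L) (s≤s P≤L′) , subst (_< suc L) (sym z′≡L) ≤-refl ,
        punchIn-<⁺ (barOne⇒ltrMin g g-inj z (subst (BarOne g ∘ suc) (sym z≡L′) barOne) a a<z)
        where
        z : Fin m
        z = fromℕ< L≤m
        z≡L′ : toℕ z ≡ L′
        z≡L′ = toℕ-fromℕ< L≤m
        z′≡L : toℕ (punchIn p z) ≡ L
        z′≡L = trans (toℕ-punchIn-≥ p z (subst (P ≤_) (sym z≡L′) P≤L′)) (cong suc z≡L′)
        a<z : toℕ a < toℕ z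
        a<z = subst (toℕ a <_) (sym z≡L′) (<-≤-trans (≤-<-trans (toℕ≤toℕ-punchIn p a) a<p) P≤L′)

  first-punchIn : 0 < P → ∃ λ j → Fin.zero ≡ punchIn p j
  first-punchIn 0<P = <P⇒punchIn Fin.zero 0<P

  ¬barOne-after : 0 < P → ¬ BarOne f (suc P)
  ¬barOne-after 0<P barOne with first-punchIn 0<P
  ... | j , 0≡j′ with barOne Fin.zero p 0<P ≤-refl (subst (λ x → f x < f p) (sym 0≡j′) (f-punchIn<f-p j))
  ...   | e , P<e , e≤P , _ = <-irrefl refl (<-≤-trans P<e (s≤s⁻¹ e≤P))

  ¬barFour-after : 0 < P → ∀ {L} → P < L → ¬ BarFour f L
  ¬barFour-after 0<P P<L barFour with first-punchIn 0<P
  ... | j , 0≡j′ with barFour Fin.zero p 0<P P<L (subst (λ x → f x < f p) (sym 0≡j′) (f-punchIn<f-p j))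
  ...   | _ , () , _

  barFour-first : P ≡ 0 → ∀ L → BarFour f L
  barFour-first P≡0 L a′ b′ a<b _ fa<fb
    with punchIn-onto p b′ (λ { refl → n≮0 (subst (toℕ a′ <_) P≡0 a<b) })
  ... | b , refl with f<N⇒punchIn a′ (<-trans fa<fb (f-punchIn<N b))
  ...   | a , refl =
    p , subst (_< toℕ (punchIn p a)) (sym P≡0)
          (subst (0 <_) (sym (toℕ-punchIn-≥ p a (subst (_≤ toℕ a) (sym P≡0) z≤n))) (s≤s z≤n)) ,
    f-punchIn<f-p b

sumWhere : (ℕ → Bool) → (ℕ → ℕ) → ℕ → ℕ
sumWhere b h zero    = 0
sumWhere b h (suc K) = sumWhere b h K + (if b K then h K else 0)

countWhere : (ℕ → Bool) → ℕ → ℕ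
countWhere b = sumWhere b (λ _ → 1)

sumWhere-suc : ∀ b h K → sumWhere b h (suc K) ≡ (if b 0 then h 0 else 0) + sumWhere (b ∘ suc) (h ∘ suc) K
sumWhere-suc b h zero    = sym (+-identityʳ _)
sumWhere-suc b h (suc K) =
  trans (cong (_+ (if b (suc K) then h (suc K) else 0)) (sumWhere-suc b h K)) (+-assoc (if b 0 then h 0 else 0) _ _)

sumWhere-+ : ∀ b h K k → sumWhere b h (K + k) ≡ sumWhere b h K + sumWhere (b ∘ (K +_)) (h ∘ (K +_)) k
sumWhere-+ b h K zero    = trans (cong (sumWhere b h) (+-identityʳ K)) (sym (+-identityʳ _))
sumWhere-+ b h K (suc k) = begin
  sumWhere b h (K + suc k)                                            ≡⟨ cong (sumWhere b h) (+-suc K k) ⟩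
  sumWhere b h (K + k) + last                                         ≡⟨ cong (_+ last) (sumWhere-+ b h K k) ⟩
  sumWhere b h K + sumWhere (b ∘ (K +_)) (h ∘ (K +_)) k + last        ≡⟨ +-assoc (sumWhere b h K) _ last ⟩
  sumWhere b h K + sumWhere (b ∘ (K +_)) (h ∘ (K +_)) (suc k)         ∎
  where
  last = if b (K + k) then h (K + k) else 0

sumWhere-congᵇ : ∀ {b b′} h K → (∀ L → L < K → b L ≡ b′ L) → sumWhere b h K ≡ sumWhere b′ h K
sumWhere-congᵇ h zero    b≗b′ = refl
sumWhere-congᵇ {b} {b′} h (suc K) b≗b′ = cong₂ _+_
  (sumWhere-congᵇ h K (λ L L<K → b≗b′ L (m<n⇒m<1+n L<K)))
  (cong (λ x → if x then h K else 0) (b≗b′ K ≤-refl))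

sumWhere-congʰ : ∀ b {h h′} K → (∀ L → L < K → b L ≡ true → h L ≡ h′ L) → sumWhere b h K ≡ sumWhere b h′ K
sumWhere-congʰ b zero    h≗h′ = refl
sumWhere-congʰ b {h} {h′} (suc K) h≗h′ =
  cong₂ _+_ (sumWhere-congʰ b K (λ L L<K → h≗h′ L (m<n⇒m<1+n L<K))) (last (b K) refl)
  where
  last : ∀ x → b K ≡ x → (if x then h K else 0) ≡ (if x then h′ K else 0)
  last true  bK = h≗h′ K ≤-refl bK
  last false _  = refl

sumWhere-none : ∀ b h K → (∀ L → L < K → b L ≡ false) → sumWhere b h K ≡ 0
sumWhere-none b h zero    _    = refl
sumWhere-none b h (suc K) none rewrite none K ≤-refl =
  trans (+-identityʳ _) (sumWhere-none b h K (λ L L<K → none L (m<n⇒m<1+n L<K)))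

-- countWhere b (suc L) is the rank of the selected index L.
sumWhere-rank : ∀ b F K → sumWhere b (λ L → F (countWhere b (suc L))) K ≡ sumFrom1To F (countWhere b K)
sumWhere-rank b F zero = refl
sumWhere-rank b F (suc K) rewrite sumWhere-rank b F K with b K
... | true  rewrite +-comm (countWhere b K) 1 = refl
... | false rewrite +-identityʳ (countWhere b K) = +-identityʳ _

clamp : (n L : ℕ) → Fin (suc n)
clamp n       zero    = Fin.zero
clamp zero    (suc L) = Fin.zero
clamp (suc n) (suc L) = Fin.suc (clamp n L)

toℕ-clamp : ∀ n L → L ≤ n → toℕ (clamp n L) ≡ L
toℕ-clamp n       zero    _         = refl
toℕ-clamp (suc n) (suc L) (s≤s L≤n) = cong suc (toℕ-clamp n L L≤n)

clamp-toℕ : ∀ n (p : Fin (suc n)) → clamp n (toℕ p) ≡ p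
clamp-toℕ n       Fin.zero    = refl
clamp-toℕ (suc n) (Fin.suc p) = cong Fin.suc (clamp-toℕ n p)

lookup-ext : ∀ {A : Set} {n} {xs ys : Vec A n} → (∀ i → lookup xs i ≡ lookup ys i) → xs ≡ ys
lookup-ext {xs = xs} {ys} xs≗ys =
  trans (sym (tabulate∘lookup xs)) (trans (tabulate-cong xs≗ys) (tabulate∘lookup ys))

lookup-removeAt : ∀ {A : Set} {n} (xs : Vec A (suc n)) i (j : Fin n) →
  lookup (removeAt xs i) j ≡ lookup xs (punchIn i j)
lookup-removeAt xs i j = trans (cong (lookup (removeAt xs i)) (sym (punchOut-punchIn i)))
  (removeAt-punchOut xs (punchInᵢ≢i i j ∘ sym))

insertMax : ∀ {n} → Vec (Fin n) n → Fin (suc n) → Vec (Fin (suc n)) (suc n)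
insertMax {n} σ p = insertAt (Vec.map inject₁ σ) p (fromℕ n)

lookup-insertMax-p : ∀ {n} (σ : Vec (Fin n) n) p → lookup (insertMax σ p) p ≡ fromℕ n
lookup-insertMax-p σ p = insertAt-lookup _ p _

lookup-insertMax-punchIn : ∀ {n} (σ : Vec (Fin n) n) p j →
  lookup (insertMax σ p) (punchIn p j) ≡ inject₁ (lookup σ j)
lookup-insertMax-punchIn σ p j = trans (insertAt-punchIn _ p _ j) (lookup-map j inject₁ σ)

module InsertMaxVec {n} (σ : Vec (Fin n) n) (p : Fin (suc n)) =
  InsertMaximum (val (insertMax σ p)) (val σ) p n
    (trans (cong toℕ (lookup-insertMax-p σ p)) (toℕ-fromℕ n))
    (λ j → trans (cong toℕ (lookup-insertMax-punchIn σ p j)) (toℕ-inject₁ _))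
    (λ j → toℕ<n (lookup σ j))

insertMax-injective : ∀ {n} (σ τ : Vec (Fin n) n) p q → insertMax σ p ≡ insertMax τ q → p ≡ q × σ ≡ τ
insertMax-injective σ τ p q eq = p≡q , σ≡τ
  where
  p≡q : p ≡ q
  p≡q with p Fin.≟ q
  ... | yes p≡q = p≡q
  ... | no  p≢q with punchIn-onto q p p≢q
  ...   | j , refl = ⊥-elim (fromℕ≢inject₁ (begin
    fromℕ _                           ≡⟨ lookup-insertMax-p σ (punchIn q j) ⟨
    lookup (insertMax σ (punchIn q j)) (punchIn q j)  ≡⟨ cong (λ v → lookup v (punchIn q j)) eq ⟩
    lookup (insertMax τ q) (punchIn q j)              ≡⟨ lookup-insertMax-punchIn τ q j ⟩
    inject₁ (lookup τ j)                              ∎))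
  σ≡τ : σ ≡ τ
  σ≡τ = lookup-ext λ j → inject₁-injective (begin
    inject₁ (lookup σ j)                  ≡⟨ lookup-insertMax-punchIn σ p j ⟨
    lookup (insertMax σ p) (punchIn p j)  ≡⟨ cong (λ v → lookup v (punchIn p j)) eq ⟩
    lookup (insertMax τ q) (punchIn p j)  ≡⟨ cong (λ r → lookup (insertMax τ r) (punchIn p j)) p≡q ⟨
    lookup (insertMax τ p) (punchIn p j)  ≡⟨ lookup-insertMax-punchIn τ p j ⟩
    inject₁ (lookup τ j)                  ∎)

insertMax-isPerm : ∀ {n} (σ : Vec (Fin n) n) p → IsPerm σ ⇔ IsPerm (insertMax σ p)
insertMax-isPerm σ p = mk⇔
  (λ σ-perm {x} {y} eq → InsertMaxVec.injective⁺ σ p (λ e → σ-perm (toℕ-injective e)) (cong toℕ eq))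
  (λ π-perm {j} {k} eq → InsertMaxVec.injective⁻ σ p (λ e → π-perm (toℕ-injective e)) (cong toℕ eq))

position-of-max : ∀ {n} (π : Vec (Fin (suc n)) (suc n)) → IsPerm π → ∃ λ m → lookup π m ≡ fromℕ n
position-of-max {n} π π-perm with any? (λ i → lookup π i Fin.≟ fromℕ n)
... | yes found = found
... | no  absent with pigeonhole (n<1+n n) (λ i → lower₁ (lookup π i) (≢max i))
  where
  ≢max : ∀ i → n ≢ toℕ (lookup π i)
  ≢max i n≡πi = absent (i , toℕ-injective (trans (sym n≡πi) (sym (toℕ-fromℕ n))))
... | i , j , i<j , πi≡πj = ⊥-elim (<-irrefl (cong toℕ (π-perm (toℕ-injective
        (trans (sym (toℕ-lower₁ _ _)) (trans (cong toℕ πi≡πj) (toℕ-lower₁ _ _)))))) i<j)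

insertMax-surjective : ∀ {n} (π : Vec (Fin (suc n)) (suc n)) → IsPerm π →
  ∃ λ σ → ∃ λ m → π ≡ insertMax σ m
insertMax-surjective {n} π π-perm with position-of-max π π-perm
... | m , πm≡max = σ , m , sym insertMax-σ
  where
  ≢max : ∀ j → n ≢ toℕ (lookup (removeAt π m) j)
  ≢max j n≡πj = punchInᵢ≢i m j (π-perm (trans (sym (lookup-removeAt π m j))
    (toℕ-injective (trans (sym n≡πj) (trans (sym (toℕ-fromℕ n)) (cong toℕ (sym πm≡max)))))))
  σ : Vec (Fin n) n
  σ = tabulate λ j → lower₁ (lookup (removeAt π m) j) (≢max j)
  inject-σ : Vec.map inject₁ σ ≡ removeAt π m
  inject-σ = lookup-ext λ j →
    trans (lookup-map j inject₁ σ) (trans (cong inject₁ (lookup∘tabulate _ j)) (inject₁-lower₁ _ (≢max j)))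
  insertMax-σ : insertMax σ m ≡ π
  insertMax-σ = begin
    insertAt (Vec.map inject₁ σ) m (fromℕ n)  ≡⟨ cong (λ v → insertAt v m (fromℕ n)) inject-σ ⟩
    insertAt (removeAt π m) m (fromℕ n)       ≡⟨ cong (insertAt (removeAt π m) m) πm≡max ⟨
    insertAt (removeAt π m) m (lookup π m)    ≡⟨ insertAt-removeAt π m ⟩
    π                                         ∎

-- The generating tree of the avoiders

activeSite : ∀ {n} → Vec (Fin n) n → ℕ → Bool
activeSite σ L = does (active? (val σ) L)

barOneSite : ∀ {n} → Vec (Fin n) n → ℕ → Bool
barOneSite σ L = does (barOne? (val σ) L)

-- Site 0 is always active, so it is left out of the label.
labelC : ∀ {n} → Vec (Fin n) n → ℕ
labelC {n} σ = countWhere (activeSite σ ∘ suc) n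

labelT : ∀ {n} → Vec (Fin n) n → ℕ
labelT {n} σ = countWhere (barOneSite σ ∘ suc) n

activeSite-zero : ∀ {n} (σ : Vec (Fin n) n) → activeSite σ 0 ≡ true
activeSite-zero σ = dec-true (active? (val σ) 0) (active-zero (val σ))

barOneSite-zero : ∀ {n} (σ : Vec (Fin n) n) → barOneSite σ 0 ≡ true
barOneSite-zero σ = dec-true (barOne? (val σ) 0) (barOne-zero (val σ))

countWhere-first : ∀ b K → b 0 ≡ true → countWhere b (suc K) ≡ suc (countWhere (b ∘ suc) K)
countWhere-first b K b0 rewrite sumWhere-suc b (λ _ → 1) K | b0 = refl

module _ {n} (σ : Vec (Fin n) n) (σ-perm : IsPerm σ) where

  private
    val-inj : Injective _≡_ _≡_ (val σ)
    val-inj eq = σ-perm (toℕ-injective eq)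

  -- After a front insertion BarFour holds at every site, and site L + 1 of the
  -- child is BarOne exactly when site L of σ is.
  labels-insertMax-first :
    labelC (insertMax σ Fin.zero) ≡ suc (labelT σ) × labelT (insertMax σ Fin.zero) ≡ suc (labelT σ)
  labels-insertMax-first =
    trans (sumWhere-congᵇ _ (suc n) activeSite-suc) (countWhere-first (barOneSite σ) n (barOneSite-zero σ)) ,
    trans (sumWhere-congᵇ _ (suc n) barOneSite-suc) (countWhere-first (barOneSite σ) n (barOneSite-zero σ))
    where
    open InsertMaxVec σ Fin.zero
    activeSite-suc : ∀ L → L < suc n → activeSite (insertMax σ Fin.zero) (suc L) ≡ barOneSite σ L
    activeSite-suc L L≤n = does-⇔
      (barOne-after val-inj (s≤s⁻¹ L≤n) (inj₁ refl) ⇔-∘ mk⇔ proj₂ (barFour-first refl (suc L) ,_))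
      (active? (val (insertMax σ Fin.zero)) (suc L)) (barOne? (val σ) L)
    barOneSite-suc : ∀ L → L < suc n → barOneSite (insertMax σ Fin.zero) (suc L) ≡ barOneSite σ L
    barOneSite-suc L L≤n = does-⇔ (barOne-after val-inj (s≤s⁻¹ L≤n) (inj₁ refl))
      (barOne? (val (insertMax σ Fin.zero)) (suc L)) (barOne? (val σ) L)

  module _ (p : Fin (suc n)) (0<P : 0 < toℕ p) where
    open InsertMaxVec σ p

    private
      π : Vec (Fin (suc n)) (suc n)
      π = insertMax σ p

      k : ℕ
      k = n ∸ P

      n≡P+k : n ≡ P + k
      n≡P+k = sym (m+[n∸m]≡n (s≤s⁻¹ (toℕ<n p)))

      1+n≡P+1+k : suc n ≡ P + suc k
      1+n≡P+1+k = trans (cong suc n≡P+k) (sym (+-suc P k))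

    labelC-insertMax-later : labelC π ≡ countWhere (activeSite σ ∘ suc) P
    labelC-insertMax-later = begin
      countWhere (activeSite π ∘ suc) (suc n)
        ≡⟨ cong (countWhere (activeSite π ∘ suc)) 1+n≡P+1+k ⟩
      countWhere (activeSite π ∘ suc) (P + suc k)
        ≡⟨ sumWhere-+ (activeSite π ∘ suc) _ P (suc k) ⟩
      countWhere (activeSite π ∘ suc) P + countWhere (activeSite π ∘ suc ∘ (P +_)) (suc k)
        ≡⟨ cong₂ _+_ (sumWhere-congᵇ _ P before) (sumWhere-none _ _ (suc k) after) ⟩
      countWhere (activeSite σ ∘ suc) P + 0
        ≡⟨ +-identityʳ _ ⟩
      countWhere (activeSite σ ∘ suc) P  ∎
      where
      before : ∀ L → L < P → activeSite π (suc L) ≡ activeSite σ (suc L)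
      before L L<P = does-⇔ (barFour-before L<P ×-⇔ barOne-before L<P)
        (active? (val π) (suc L)) (active? (val σ) (suc L))
      after : ∀ L → L < suc k → activeSite π (suc (P + L)) ≡ false
      after L _ = dec-false (active? (val π) (suc (P + L)))
        (¬barFour-after 0<P (s≤s (m≤m+n P L)) ∘ proj₁)

    labelT-insertMax-later : labelT π ≡ labelT σ
    labelT-insertMax-later = begin
      countWhere (barOneSite π ∘ suc) (suc n)
        ≡⟨ cong (countWhere (barOneSite π ∘ suc)) 1+n≡P+1+k ⟩
      countWhere (barOneSite π ∘ suc) (P + suc k)
        ≡⟨ sumWhere-+ (barOneSite π ∘ suc) _ P (suc k) ⟩
      countWhere (barOneSite π ∘ suc) P + countWhere (barOneSite π ∘ suc ∘ (P +_)) (suc k)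
        ≡⟨ cong (countWhere (barOneSite π ∘ suc) P +_) (sumWhere-suc (barOneSite π ∘ suc ∘ (P +_)) _ k) ⟩
      countWhere (barOneSite π ∘ suc) P
        + ((if barOneSite π (suc (P + 0)) then 1 else 0) + countWhere (barOneSite π ∘ suc ∘ (P +_) ∘ suc) k)
        ≡⟨ cong₂ _+_ (sumWhere-congᵇ _ P before)
                     (cong₂ _+_ (cong (λ x → if x then 1 else 0) atP+1) (sumWhere-congᵇ _ k after)) ⟩
      countWhere (barOneSite σ ∘ suc) P + countWhere (barOneSite σ ∘ suc ∘ (P +_)) k
        ≡⟨ sumWhere-+ (barOneSite σ ∘ suc) _ P k ⟨
      countWhere (barOneSite σ ∘ suc) (P + k)
        ≡⟨ cong (countWhere (barOneSite σ ∘ suc)) n≡P+k ⟨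
      countWhere (barOneSite σ ∘ suc) n  ∎
      where
      before : ∀ L → L < P → barOneSite π (suc L) ≡ barOneSite σ (suc L)
      before L L<P = does-⇔ (barOne-before L<P) (barOne? (val π) (suc L)) (barOne? (val σ) (suc L))
      atP+1 : barOneSite π (suc (P + 0)) ≡ false
      atP+1 = dec-false (barOne? (val π) (suc (P + 0)))
        (¬barOne-after 0<P ∘ subst (BarOne (val π) ∘ suc) (+-identityʳ P))
      after : ∀ L → L < k → barOneSite π (suc (P + suc L)) ≡ barOneSite σ (suc (P + L))
      after L L<k = trans (cong (barOneSite π ∘ suc) (+-suc P L))
        (does-⇔ (barOne-after val-inj {suc (P + L)} (subst₂ _≤_ (+-suc P L) (sym n≡P+k) (+-monoʳ-≤ P L<k))
                                (inj₂ (s≤s (m≤m+n P L))))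
          (barOne? (val π) (suc (suc (P + L)))) (barOne? (val σ) (suc (P + L))))

children : ∀ {n} → Vec (Fin n) n → ℕ → List (Vec (Fin (suc n)) (suc n))
children σ zero        = []
children {n} σ (suc K) = children σ K ++ (if activeSite σ K then insertMax σ (clamp n K) ∷ [] else [])

weight : ∀ {n} → ℕ → Vec (Fin n) n → ℕ
weight d σ = nodes d (labelC σ) (labelT σ)

sum-map-children : ∀ {n} (w : Vec (Fin (suc n)) (suc n) → ℕ) (σ : Vec (Fin n) n) K →
  sum (map w (children σ K)) ≡ sumWhere (activeSite σ) (w ∘ insertMax σ ∘ clamp n) K
sum-map-children w σ zero    = refl
sum-map-children {n} w σ (suc K) = begin
  sum (map w (children σ K ++ new))              ≡⟨ cong sum (map-++ w (children σ K) new) ⟩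
  sum (map w (children σ K) ++ map w new)        ≡⟨ sum-++ (map w (children σ K)) (map w new) ⟩
  sum (map w (children σ K)) + sum (map w new)   ≡⟨ cong₂ _+_ (sum-map-children w σ K) (last (activeSite σ K)) ⟩
  sumWhere (activeSite σ) (w ∘ insertMax σ ∘ clamp n) (suc K)  ∎
  where
  new = if activeSite σ K then insertMax σ (clamp n K) ∷ [] else []
  last : ∀ x → sum (map w (if x then insertMax σ (clamp n K) ∷ [] else []))
               ≡ (if x then w (insertMax σ (clamp n K)) else 0)
  last true  = +-identityʳ _
  last false = refl

-- The children of σ realise the succession rule (c , t) ↝ (t+1 , t+1) (1 , t) … (c , t).
sum-weight-children : ∀ {n} d (σ : Vec (Fin n) n) → IsPerm σ →
  sum (map (weight d) (children σ (suc n))) ≡ weight (suc d) σ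
sum-weight-children {n} d σ σ-perm = begin
  sum (map (weight d) (children σ (suc n)))
    ≡⟨ sum-map-children (weight d) σ (suc n) ⟩
  sumWhere (activeSite σ) (weight d ∘ insertMax σ ∘ clamp n) (suc n)
    ≡⟨ sumWhere-suc (activeSite σ) _ n ⟩
  (if activeSite σ 0 then weight d (insertMax σ Fin.zero) else 0) + sumWhere b (weight d ∘ insertMax σ ∘ clamp n ∘ suc) n
    ≡⟨ cong₂ _+_ first (sumWhere-congʰ b n later) ⟩
  nodes d (suc t) (suc t) + sumWhere b (λ L → nodes d (countWhere b (suc L)) t) n
    ≡⟨ cong (nodes d (suc t) (suc t) +_) (sumWhere-rank b (λ j → nodes d j t) n) ⟩
  weight (suc d) σ  ∎
  where
  b = activeSite σ ∘ suc
  t = labelT σ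
  first : (if activeSite σ 0 then weight d (insertMax σ Fin.zero) else 0) ≡ nodes d (suc t) (suc t)
  first rewrite activeSite-zero σ =
    let c≡1+t , t≡1+t = labels-insertMax-first σ σ-perm in cong₂ (nodes d) c≡1+t t≡1+t
  later : ∀ L → L < n → b L ≡ true → weight d (insertMax σ (clamp n (suc L))) ≡ nodes d (countWhere b (suc L)) t
  later L L<n _ = cong₂ (nodes d)
    (trans (labelC-insertMax-later σ σ-perm p 0<P) (cong (countWhere b) P≡1+L))
    (labelT-insertMax-later σ σ-perm p 0<P)
    where
    p = clamp n (suc L)
    P≡1+L : toℕ p ≡ suc L
    P≡1+L = toℕ-clamp n (suc L) L<n
    0<P : 0 < toℕ p
    0<P = subst (0 <_) (sym P≡1+L) (s≤s z≤n)

∈-children⁻ : ∀ {n} (σ : Vec (Fin n) n) K {π} → π ∈ children σ K →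
  ∃ λ L → L < K × Active (val σ) L × π ≡ insertMax σ (clamp n L)
∈-children⁻ σ (suc K) π∈ with ∈-++⁻ (children σ K) π∈
... | inj₁ π∈old = let L , L<K , act , eq = ∈-children⁻ σ K π∈old in L , m<n⇒m<1+n L<K , act , eq
... | inj₂ π∈new with active? (val σ) K | π∈new
...   | yes act | here refl = K , ≤-refl , act , refl

∈-children⁺ : ∀ {n} (σ : Vec (Fin n) n) K {L} → L < K → Active (val σ) L → insertMax σ (clamp n L) ∈ children σ K
∈-children⁺ σ (suc K) L<1+K act with m<1+n⇒m<n∨m≡n L<1+K
... | inj₁ L<K  = ∈-++⁺ˡ (∈-children⁺ σ K L<K act)
... | inj₂ refl with active? (val σ) K
...   | yes _   = ∈-++⁺ʳ (children σ K) (here refl)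
...   | no  ¬act = ⊥-elim (¬act act)

insertMax-clamp-injective : ∀ {n} (σ τ : Vec (Fin n) n) {L L′} → L ≤ n → L′ ≤ n →
  insertMax σ (clamp n L) ≡ insertMax τ (clamp n L′) → L ≡ L′ × σ ≡ τ
insertMax-clamp-injective {n} σ τ {L} {L′} L≤n L′≤n eq =
  let p≡q , σ≡τ = insertMax-injective σ τ _ _ eq
  in trans (sym (toℕ-clamp n L L≤n)) (trans (cong toℕ p≡q) (toℕ-clamp n L′ L′≤n)) , σ≡τ

children-unique : ∀ {n} (σ : Vec (Fin n) n) K → K ≤ suc n → Unique (children σ K)
children-unique σ zero    _      = AllPairs.[]
children-unique σ (suc K) 1+K≤1+n with active? (val σ) K
... | no  _ = subst Unique (sym (++-identityʳ (children σ K))) (children-unique σ K (<⇒≤ 1+K≤1+n))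
... | yes _ = Unique.++⁺ (children-unique σ K (<⇒≤ 1+K≤1+n)) (All.[] AllPairs.∷ AllPairs.[]) fresh
  where
  fresh : Disjoint (children σ K) (insertMax σ (clamp _ K) ∷ [])
  fresh (π∈old , here refl) =
    let L , L<K , _ , eq = ∈-children⁻ σ K π∈old
        K≤n = s≤s⁻¹ 1+K≤1+n
    in <-irrefl (proj₁ (insertMax-clamp-injective σ σ (≤-trans (<⇒≤ L<K) K≤n) K≤n (sym eq))) L<K

children-disjoint : ∀ {n} (σ τ : Vec (Fin n) n) → σ ≢ τ → Disjoint (children σ (suc n)) (children τ (suc n))
children-disjoint σ τ σ≢τ (π∈σ , π∈τ) =
  let L , L≤n , _ , eq₁ = ∈-children⁻ σ _ π∈σ
      L′ , L′≤n , _ , eq₂ = ∈-children⁻ τ _ π∈τ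
  in σ≢τ (proj₂ (insertMax-clamp-injective σ τ (s≤s⁻¹ L≤n) (s≤s⁻¹ L′≤n) (trans (sym eq₁) eq₂)))

avoiders : (n : ℕ) → List (Vec (Fin n) n)
avoiders zero    = Vec.[] ∷ []
avoiders (suc n) = concatMap (λ σ → children σ (suc n)) (avoiders n)

avoiders-sound : ∀ n {π} → π ∈ avoiders n → IsPerm π × Avoids π
avoiders-sound zero    {Vec.[]} _ = (λ {}) , λ ()
avoiders-sound (suc n) π∈ with find (∈-concatMap⁻ (λ σ → children σ (suc n)) π∈)
... | σ , σ∈ , π∈children with ∈-children⁻ σ (suc n) π∈children | avoiders-sound n σ∈
...   | L , L≤n , act , refl | σ-perm , σ-avoids =
  Equivalence.to (insertMax-isPerm σ p) σ-perm ,
  InsertMaxVec.active⇒avoids σ p σ-avoids (subst (Active (val σ)) (sym (toℕ-clamp n L (s≤s⁻¹ L≤n))) act)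
  where p = clamp n L

avoiders-complete : ∀ n (π : Vec (Fin n) n) → IsPerm π → Avoids π → π ∈ avoiders n
avoiders-complete zero    Vec.[] _ _ = here refl
avoiders-complete (suc n) π π-perm π-avoids with insertMax-surjective π π-perm
... | σ , p , refl = ∈-concatMap⁺ (λ σ → children σ (suc n)) (lose σ∈ π∈children)
  where
  σ∈ : σ ∈ avoiders n
  σ∈ = avoiders-complete n σ (Equivalence.from (insertMax-isPerm σ p) π-perm) (InsertMaxVec.avoids-remove σ p π-avoids)
  π∈children : insertMax σ p ∈ children σ (suc n)
  π∈children = subst (λ q → insertMax σ q ∈ children σ (suc n)) (clamp-toℕ n p)
    (∈-children⁺ σ (suc n) (toℕ<n p) (InsertMaxVec.avoids⇒active σ p π-avoids))

avoiders-unique : ∀ n → Unique (avoiders n)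
avoiders-unique zero    = All.[] AllPairs.∷ AllPairs.[]
avoiders-unique (suc n) = Unique.concat⁺
  (All.map⁺ (All.universal (λ σ → children-unique σ (suc n) ≤-refl) (avoiders n)))
  (AllPairs.map⁺ (AllPairs.map (children-disjoint _ _) (avoiders-unique n)))

sum-map-concatMap : ∀ {A B : Set} (w : B → ℕ) (f : A → List B) xs →
  sum (map w (concatMap f xs)) ≡ sum (map (λ x → sum (map w (f x))) xs)
sum-map-concatMap w f []       = refl
sum-map-concatMap w f (x ∷ xs) = begin
  sum (map w (f x ++ concatMap f xs))                   ≡⟨ cong sum (map-++ w (f x) (concatMap f xs)) ⟩
  sum (map w (f x) ++ map w (concatMap f xs))           ≡⟨ sum-++ (map w (f x)) (map w (concatMap f xs)) ⟩
  sum (map w (f x)) + sum (map w (concatMap f xs))      ≡⟨ cong (sum (map w (f x)) +_) (sum-map-concatMap w f xs) ⟩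
  sum (map w (f x)) + sum (map (λ x → sum (map w (f x))) xs)  ∎

sum-weight-avoiders : ∀ n d → sum (map (weight d) (avoiders n)) ≡ nodes (n + d) 0 0
sum-weight-avoiders zero    d = +-identityʳ (nodes d 0 0)
sum-weight-avoiders (suc n) d = begin
  sum (map (weight d) (concatMap (λ σ → children σ (suc n)) (avoiders n)))
    ≡⟨ sum-map-concatMap (weight d) (λ σ → children σ (suc n)) (avoiders n) ⟩
  sum (map (λ σ → sum (map (weight d) (children σ (suc n)))) (avoiders n))
    ≡⟨ cong sum (map-cong-local (All.tabulate λ σ∈ → sum-weight-children d _ (proj₁ (avoiders-sound n σ∈)))) ⟩
  sum (map (weight (suc d)) (avoiders n))
    ≡⟨ sum-weight-avoiders n (suc d) ⟩
  nodes (n + suc d) 0 0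
    ≡⟨ cong (λ m → nodes m 0 0) (+-suc n d) ⟩
  nodes (suc n + d) 0 0  ∎

sum-map-1≡length : ∀ {A : Set} (xs : List A) → sum (map (λ _ → 1) xs) ≡ length xs
sum-map-1≡length []       = refl
sum-map-1≡length (_ ∷ xs) = cong suc (sum-map-1≡length xs)

length-avoiders : ∀ n → length (avoiders n) ≡ formula n
length-avoiders n = begin
  length (avoiders n)                    ≡⟨ sum-map-1≡length (avoiders n) ⟨
  sum (map (weight 0) (avoiders n))      ≡⟨ sum-weight-avoiders n 0 ⟩
  nodes (n + 0) 0 0                      ≡⟨ cong (λ m → nodes m 0 0) (+-identityʳ n) ⟩
  nodes n 0 0                            ≡⟨ formula≡nodes n ⟨
  formula n                              ∎

corollary16 : (n : ℕ) →
    Σ (List (Vec (Fin n) n)) λ L →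
      Unique L
      × ((π : Vec (Fin n) n) → (π ∈ L) ⇔ (IsPerm π × Avoids π))
      × length L ≡ formula n
corollary16 n =
  avoiders n ,
  avoiders-unique n ,
  (λ π → mk⇔ (avoiders-sound n) λ (π-perm , π-avoids) → avoiders-complete n π π-perm π-avoids) ,
  length-avoiders n
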